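{- For every integer $n\ge 1$, $$|B_x(n,2)|=n(n+1)2^{n-4}+n\,2^{n-1}+7\cdot 2^{n-3}.$$
   Context: Let $I$ (left vertices) and $O$ (right vertices) be disjoint finite sets with $|I|=n$ and $|O|=r$. An $(n,r)$-bipartite graph is $G=(I\oplus O,E)$ with edge set $E\subseteq I\times O$. The connected domain $I_c(G)$ is the set of vertices of $I$ with nonzero degree in $G$. Two $(n,r)$-bipartite graphs $G_1=(I\oplus O,E_1)$ and $G_2=(I\oplus O,E_2)$ are left-set-labeled equivalent if there exist bijections $\alpha:I\to I$ and $\beta:O\to O$ such that for all $x\in I,y\in O$, $(x,y)\in E_1$ iff $(\alpha(x),\beta(y))\in E_2$, and moreover $I_c(G_1)=I_c(G_2)$. $B_x(n,r)$ denotes the set of equivalence classes of $(n,r)$-bipartite graphs under left-set-labeled equivalence. -}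

module Defs where

open import Data.Nat using (ℕ)
open import Data.Bool using (Bool; true)
open import Data.Fin using (Fin)
open import Data.Fin.Permutation using (Permutation′; _⟨$⟩ʳ_)
open import Data.Product using (Σ; ∃-syntax; _×_)
open import Relation.Binary.PropositionalEquality using (_≡_)

-- An (n,r)-bipartite graph: I = Fin n, O = Fin r, edge set E ⊆ I × O
-- given by its characteristic function.
BipGraph : ℕ → ℕ → Set
BipGraph n r = Fin n → Fin r → Bool

InConnDomain : ∀ {n r} → BipGraph n r → Fin n → Set
InConnDomain {r = r} G x = ∃[ y ] G x y ≡ true

SameConnDomain : ∀ {n r} → BipGraph n r → BipGraph n r → Set
SameConnDomain {n} G₁ G₂ =
  (x : Fin n) → (InConnDomain G₁ x → InConnDomain G₂ x)
              × (InConnDomain G₂ x → InConnDomain G₁ x)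

LSLEquiv : ∀ {n r} → BipGraph n r → BipGraph n r → Set
LSLEquiv {n} {r} G₁ G₂ =
  (Σ (Permutation′ n) λ α → Σ (Permutation′ r) λ β →
     (x : Fin n) (y : Fin r) → G₁ x y ≡ G₂ (α ⟨$⟩ʳ x) (β ⟨$⟩ʳ y))
  × SameConnDomain G₁ G₂

HasClassCount : {A : Set} → (A → A → Set) → ℕ → Set
HasClassCount {A} R k =
  Σ (Fin k → A) λ rep →
    ((i j : Fin k) → R (rep i) (rep j) → i ≡ j)
    × ((a : A) → ∃[ i ] R a (rep i))

CardBx : ℕ → ℕ → ℕ → Set
CardBx n r k = HasClassCount (LSLEquiv {n} {r}) k

-- Up to permuting its rows, an (n,2)-graph is its family of rows, each adjacent to no output, to the
-- first, to the second, or to both.  Left-set-labeled equivalence may also swap the two outputs but must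
-- fix the set S of non-isolated rows, so its classes correspond exactly to tuples (S, a, b, c) with
-- a + b + c = |S| and b ≤ a: c counts the rows adjacent to both outputs, a ≥ b the rows adjacent to
-- exactly one of them.  Let g m count the triples with a + b + c = m, and F n j the tuples with
-- a + b + c = |S| + j.  Splitting on the first entry of S gives F (n + 1) j = F n j + F n (j + 1), and
-- the floor-free identity 2 (g j + g (j + 1)) = (j + 2)(j + 3) turns this recursion into the closed form.

module Submission where

open import Defs
open import Data.Nat using (ℕ; zero; suc; _+_; _*_; _^_; _≤_; _∸_; _⊔_; _⊓_; ⌊_/2⌋; ⌈_/2⌉; pred; z≤n; s≤s; s≤s⁻¹)
open import Data.Nat.Properties
open import Data.Nat.Tactic.RingSolver using (solve-∀)
open import Data.Empty using (⊥-elim)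
open import Data.Fin using (Fin; zero; suc; toℕ; fromℕ<; splitAt; join; _↑ˡ_; _↑ʳ_)
open import Data.Fin.Properties using (toℕ-injective; toℕ-fromℕ<; toℕ<n; splitAt-↑ˡ; splitAt-↑ʳ; join-splitAt)
open import Data.Fin.Permutation as Perm using (Permutation′; _⟨$⟩ʳ_; _⟨$⟩ˡ_; inverseˡ; lift₀; _∘ₚ_; transpose)
open import Data.Fin.Subset using (Subset; ∣_∣)
open import Data.Product using (Σ; ∃-syntax; _×_; _,_; proj₁; proj₂; swap)
open import Data.Product.Properties using (≡-dec; ,-injective)
open import Data.Sum using (_⊎_; inj₁; inj₂; [_,_]′)
open import Data.Bool using (Bool; true; false; if_then_else_; _∨_)
open import Data.Bool.Properties using (∨-comm; ∨-zeroʳ; ⇔→≡) renaming (_≟_ to _≟ᵇ_)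
open import Data.Unit using (tt)
open import Data.Vec using (Vec; []; _∷_; tabulate; lookup)
open import Data.Vec.Properties using (tabulate-cong; lookup∘tabulate)
open import Data.Fin.Patterns using (0F; 1F)
open import Function.Bundles using (mk⇔)
open import Function using (id; _∘_)
open import Function.Definitions using (Injective)
open import Level using (0ℓ)
open import Relation.Binary.PropositionalEquality
open import Relation.Binary.Definitions using (DecidableEquality)
open import Relation.Nullary using (does; yes; no; contradiction)
open import Algebra.Properties.CommutativeMonoid.Sum +-0-commutativeMonoid using (sum; sum-permute; sum-cong-≗)
open import Relation.Unary using (Pred; U; _⊆_; _∪_; _⊥_; _≐_)

-- Enumerations by Fin k

record Enumeration {A : Set} (P : Pred A 0ℓ) (k : ℕ) : Set where
  field
    enum      : Fin k → A
    injective : Injective _≡_ _≡_ enum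
    sound     : ∀ i → P (enum i)
    complete  : ∀ {a} → P a → ∃[ i ] enum i ≡ a

Image : {A B : Set} → (A → B) → Pred A 0ℓ → Pred B 0ℓ
Image f P b = ∃[ a ] P a × f a ≡ b

module _ {A : Set} {P Q : Pred A 0ℓ} where

  enumeration-resp : ∀ {k} → P ≐ Q → Enumeration P k → Enumeration Q k
  enumeration-resp (P⊆Q , Q⊆P) e = record
    { enum = enum ; injective = injective ; sound = P⊆Q ∘ sound ; complete = complete ∘ Q⊆P }
    where open Enumeration e

  enumeration-∪ : ∀ {k l} → P ⊥ Q → Enumeration P k → Enumeration Q l → Enumeration (P ∪ Q) (k + l)
  enumeration-∪ {k} {l} P⊥Q eP eQ = record
    { enum = enum ; injective = injective ; sound = sound ; complete = complete }
    where
    module EP = Enumeration eP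
    module EQ = Enumeration eQ
    enum₊ : Fin k ⊎ Fin l → A
    enum₊ = [ EP.enum , EQ.enum ]′
    enum : Fin (k + l) → A
    enum = enum₊ ∘ splitAt k
    injective₊ : Injective _≡_ _≡_ enum₊
    injective₊ {inj₁ i} {inj₁ j} eq = cong inj₁ (EP.injective eq)
    injective₊ {inj₁ i} {inj₂ j} eq = ⊥-elim (P⊥Q (EP.sound i , subst Q (sym eq) (EQ.sound j)))
    injective₊ {inj₂ i} {inj₁ j} eq = ⊥-elim (P⊥Q (EP.sound j , subst Q eq (EQ.sound i)))
    injective₊ {inj₂ i} {inj₂ j} eq = cong inj₂ (EQ.injective eq)
    injective : Injective _≡_ _≡_ enum
    injective {i} {j} eq = begin
      i                       ≡⟨ join-splitAt k l i ⟨
      join k l (splitAt k i)  ≡⟨ cong (join k l) (injective₊ {splitAt k i} {splitAt k j} eq) ⟩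
      join k l (splitAt k j)  ≡⟨ join-splitAt k l j ⟩
      j                       ∎
      where open ≡-Reasoning
    sound : ∀ i → (P ∪ Q) (enum i)
    sound i with splitAt k i
    ... | inj₁ i′ = inj₁ (EP.sound i′)
    ... | inj₂ i′ = inj₂ (EQ.sound i′)
    complete : ∀ {a} → (P ∪ Q) a → ∃[ i ] enum i ≡ a
    complete (inj₁ p) with EP.complete p
    ... | i , refl = i ↑ˡ l , cong enum₊ (splitAt-↑ˡ k i l)
    complete (inj₂ q) with EQ.complete q
    ... | i , refl = k ↑ʳ i , cong enum₊ (splitAt-↑ʳ k l i)

enumeration-image : {A B : Set} {P : Pred A 0ℓ} {k : ℕ} (f : A → B) → Injective _≡_ _≡_ f →
                    Enumeration P k → Enumeration (Image f P) k
enumeration-image f f-injective e = record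
  { enum = f ∘ enum
  ; injective = injective ∘ f-injective
  ; sound = λ i → enum i , sound i , refl
  ; complete = λ { (a , p , refl) → let i , eq = complete p in i , cong f eq }
  }
  where open Enumeration e

enumeration-Fin : ∀ k → Enumeration {Fin k} U k
enumeration-Fin k = record { enum = id ; injective = id ; sound = λ _ → tt ; complete = λ {i} _ → i , refl }

-- Counting classes by a complete invariant

record CompleteInvariant {A B : Set} (R : A → A → Set) (P : Pred B 0ℓ) : Set where
  field
    inv      : A → B
    respects : ∀ {a a′} → R a a′ → inv a ≡ inv a′
    reflects : ∀ {a a′} → inv a ≡ inv a′ → R a a′
    valid    : ∀ a → P (inv a)
    onto     : ∀ {b} → P b → ∃[ a ] inv a ≡ b

completeInvariant⇒HasClassCount : ∀ {A B : Set} {R : A → A → Set} {P : Pred B 0ℓ} {k} →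
  CompleteInvariant R P → Enumeration P k → HasClassCount R k
completeInvariant⇒HasClassCount {A = A} {R = R} {k = k} I E = rep , rep-distinct , rep-covers
  where
  open CompleteInvariant I
  open Enumeration E
  rep : Fin k → A
  rep i = proj₁ (onto (sound i))
  inv-rep : ∀ i → inv (rep i) ≡ enum i
  inv-rep i = proj₂ (onto (sound i))
  rep-distinct : ∀ i j → R (rep i) (rep j) → i ≡ j
  rep-distinct i j Rij = injective (trans (sym (inv-rep i)) (trans (respects Rij) (inv-rep j)))
  rep-covers : ∀ a → ∃[ i ] R a (rep i)
  rep-covers a = let i , enum-i≡inv-a = complete (valid a)
                 in i , reflects (trans (sym enum-i≡inv-a) (sym (inv-rep i)))

-- Multiplicities of values in a finite family

module Counting {A : Set} (_≟_ : DecidableEquality A) where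

  indicator : A → A → ℕ
  indicator u t = if does (u ≟ t) then 1 else 0

  count : ∀ {n} → (Fin n → A) → A → ℕ
  count f t = sum (λ x → indicator (f x) t)

  indicator-self : ∀ t → indicator t t ≡ 1
  indicator-self t with t ≟ t
  ... | yes _ = refl
  ... | no t≢t = contradiction refl t≢t

  indicator-cong : ∀ {u t v s} → (u ≡ t → v ≡ s) → (v ≡ s → u ≡ t) → indicator u t ≡ indicator v s
  indicator-cong {u} {t} {v} {s} to from with u ≟ t | v ≟ s
  ... | yes _   | yes _   = refl
  ... | no  _   | no  _   = refl
  ... | yes u≡t | no  v≢s = contradiction (to u≡t) v≢s
  ... | no  u≢t | yes v≡s = contradiction (from v≡s) u≢t

  count-cong : ∀ {n} {f h : Fin n → A} {t s} →
               (∀ x → f x ≡ t → h x ≡ s) → (∀ x → h x ≡ s → f x ≡ t) → count f t ≡ count h s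
  count-cong to from = sum-cong-≗ (λ x → indicator-cong (to x) (from x))

  count-permute : ∀ {n} (f : Fin n → A) (π : Permutation′ n) t → count (f ∘ (π ⟨$⟩ʳ_)) t ≡ count f t
  count-permute f π t = sym (sum-permute (λ x → indicator (f x) t) π)

  count-reindex : ∀ {n} {f h : Fin n → A} (π : Permutation′ n) → (∀ x → f x ≡ h (π ⟨$⟩ʳ x)) →
                  ∀ t → count f t ≡ count h t
  count-reindex {h = h} π f≡hπ t =
    trans (sum-cong-≗ (λ x → cong (λ u → indicator u t) (f≡hπ x))) (count-permute h π t)

  count≡suc⇒∃ : ∀ {n} (f : Fin n → A) t {k} → count f t ≡ suc k → ∃[ x ] f x ≡ t
  count≡suc⇒∃ {suc n} f t eq with f zero ≟ t
  ... | yes f0≡t = zero , f0≡t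
  ... | no  _    = let x , fx≡t = count≡suc⇒∃ (f ∘ suc) t eq in suc x , fx≡t

  -- Move a position carrying the value f 0 to the front, then recurse on the tails.
  sameCounts⇒permutation : ∀ {n} (f h : Fin n → A) → (∀ t → count f t ≡ count h t) →
                           Σ (Permutation′ n) λ π → ∀ x → f x ≡ h (π ⟨$⟩ʳ x)
  sameCounts⇒permutation {zero}  f h _    = Perm.id , λ ()
  sameCounts⇒permutation {suc n} f h same = lift₀ ρ ∘ₚ τ , λ { zero → sym hj≡f0 ; (suc x) → ρ-spec x }
    where
    witness : ∃[ j ] h j ≡ f zero
    witness = count≡suc⇒∃ h (f zero)
      (trans (sym (same (f zero))) (cong (_+ count (f ∘ suc) (f zero)) (indicator-self (f zero))))
    j : Fin (suc n)
    j = proj₁ witness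
    hj≡f0 : h j ≡ f zero
    hj≡f0 = proj₂ witness
    τ : Permutation′ (suc n)
    τ = transpose zero j
    h′ : Fin (suc n) → A
    h′ = h ∘ (τ ⟨$⟩ʳ_)
    same′ : ∀ t → count (f ∘ suc) t ≡ count (h′ ∘ suc) t
    same′ t = +-cancelˡ-≡ (indicator (f zero) t) _ _ (begin
      indicator (f zero) t + count (f ∘ suc) t  ≡⟨ same t ⟩
      count h t                                 ≡⟨ count-permute h τ t ⟨
      indicator (h j) t + count (h′ ∘ suc) t    ≡⟨ cong (λ u → indicator u t + count (h′ ∘ suc) t) hj≡f0 ⟩
      indicator (f zero) t + count (h′ ∘ suc) t ∎)
      where open ≡-Reasoning
    tail-permutation : Σ (Permutation′ n) λ ρ → ∀ x → f (suc x) ≡ h′ (suc (ρ ⟨$⟩ʳ x))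
    tail-permutation = sameCounts⇒permutation (f ∘ suc) (h′ ∘ suc) same′
    ρ : Permutation′ n
    ρ = proj₁ tail-permutation
    ρ-spec : ∀ x → f (suc x) ≡ h′ (suc (ρ ⟨$⟩ʳ x))
    ρ-spec = proj₂ tail-permutation

-- Sorted triples and codes

m≤⌊n/2⌋⇒m+m≤n : ∀ {m} n → m ≤ ⌊ n /2⌋ → m + m ≤ n
m≤⌊n/2⌋⇒m+m≤n {m} n m≤⌊n/2⌋ = begin
  m + m               ≤⟨ +-mono-≤ m≤⌊n/2⌋ (≤-trans m≤⌊n/2⌋ (⌊n/2⌋≤⌈n/2⌉ n)) ⟩
  ⌊ n /2⌋ + ⌈ n /2⌉   ≡⟨ ⌊n/2⌋+⌈n/2⌉≡n n ⟩
  n                   ∎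
  where open ≤-Reasoning

n≤m⇒n≤⌊m+n/2⌋ : ∀ {m n} → n ≤ m → n ≤ ⌊ m + n /2⌋
n≤m⇒n≤⌊m+n/2⌋ {m} {n} n≤m = begin
  n              ≡⟨ n≡⌊n+n/2⌋ n ⟩
  ⌊ n + n /2⌋    ≤⟨ ⌊n/2⌋-mono (+-monoˡ-≤ n n≤m) ⟩
  ⌊ m + n /2⌋    ∎
  where open ≤-Reasoning

⊔⊓-sorted : ∀ a b → (a ⊔ b , a ⊓ b) ≡ (a , b) ⊎ (a ⊔ b , a ⊓ b) ≡ (b , a)
⊔⊓-sorted a b with ≤-total a b
... | inj₁ a≤b = inj₂ (cong₂ _,_ (m≤n⇒m⊔n≡n a≤b) (m≤n⇒m⊓n≡m a≤b))
... | inj₂ b≤a = inj₁ (cong₂ _,_ (m≥n⇒m⊔n≡m b≤a) (m≥n⇒m⊓n≡n b≤a))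

m⊔n+m⊓n≡m+n : ∀ m n → m ⊔ n + m ⊓ n ≡ m + n
m⊔n+m⊓n≡m+n m n with ⊔⊓-sorted m n
... | inj₁ sorted = cong (λ p → proj₁ p + proj₂ p) sorted
... | inj₂ sorted = trans (cong (λ p → proj₁ p + proj₂ p) sorted) (+-comm n m)

⊔⊓-injective : ∀ {a b a′ b′} → (a ⊔ b , a ⊓ b) ≡ (a′ ⊔ b′ , a′ ⊓ b′) →
               (a ≡ a′ × b ≡ b′) ⊎ (a ≡ b′ × b ≡ a′)
⊔⊓-injective {a} {b} {a′} {b′} eq with ⊔⊓-sorted a b | ⊔⊓-sorted a′ b′
... | inj₁ p | inj₁ q = inj₁ (,-injective (trans (sym p) (trans eq q)))
... | inj₁ p | inj₂ q = inj₂ (,-injective (trans (sym p) (trans eq q)))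
... | inj₂ p | inj₁ q = inj₂ (swap (,-injective (trans (sym p) (trans eq q))))
... | inj₂ p | inj₂ q = inj₁ (swap (,-injective (trans (sym p) (trans eq q))))

Triple : Set
Triple = ℕ × ℕ × ℕ

ValidTriple : ℕ → Pred Triple 0ℓ
ValidTriple m (a , b , c) = a + b + c ≡ m × b ≤ a

tripleCount : ℕ → ℕ
tripleCount zero    = 1
tripleCount (suc m) = tripleCount m + suc ⌊ suc m /2⌋

incrementLast : Triple → Triple
incrementLast (a , b , c) = a , b , suc c

twoParts : ∀ m → Fin (suc ⌊ m /2⌋) → Triple
twoParts m q = m ∸ toℕ q , toℕ q , 0

twoParts-valid : ∀ m q → ValidTriple m (twoParts m q)
twoParts-valid m q = trans (+-identityʳ _) (m∸n+n≡m b≤m) , m+n≤o⇒m≤o∸n b b+b≤m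
  where
  b : ℕ
  b = toℕ q
  b+b≤m : b + b ≤ m
  b+b≤m = m≤⌊n/2⌋⇒m+m≤n m (s≤s⁻¹ (toℕ<n q))
  b≤m : b ≤ m
  b≤m = m+n≤o⇒n≤o b b+b≤m

ValidTriple-suc : ∀ m →
  Image incrementLast (ValidTriple m) ∪ Image (twoParts (suc m)) U ≐ ValidTriple (suc m)
ValidTriple-suc m = merge , split
  where
  merge : Image incrementLast (ValidTriple m) ∪ Image (twoParts (suc m)) U ⊆ ValidTriple (suc m)
  merge (inj₁ ((a , b , c) , (sum≡ , b≤a) , refl)) = trans (+-suc (a + b) c) (cong suc sum≡) , b≤a
  merge (inj₂ (q , _ , refl))                      = twoParts-valid (suc m) q
  split : ValidTriple (suc m) ⊆ Image incrementLast (ValidTriple m) ∪ Image (twoParts (suc m)) U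
  split {a , b , suc c} (sum≡ , b≤a) =
    inj₁ ((a , b , c) , (suc-injective (trans (sym (+-suc (a + b) c)) sum≡) , b≤a) , refl)
  split {a , b , zero}  (sum≡ , b≤a) = inj₂ (q , tt , cong₂ (λ a′ b′ → a′ , b′ , 0) a≡ toℕq≡b)
    where
    a+b≡ : a + b ≡ suc m
    a+b≡ = trans (sym (+-identityʳ (a + b))) sum≡
    b≤half : b ≤ ⌊ suc m /2⌋
    b≤half = subst (λ s → b ≤ ⌊ s /2⌋) a+b≡ (n≤m⇒n≤⌊m+n/2⌋ b≤a)
    q : Fin (suc ⌊ suc m /2⌋)
    q = fromℕ< (s≤s b≤half)
    toℕq≡b : toℕ q ≡ b
    toℕq≡b = toℕ-fromℕ< (s≤s b≤half)
    a≡ : suc m ∸ toℕ q ≡ a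
    a≡ = trans (cong₂ _∸_ (sym a+b≡) toℕq≡b) (m+n∸n≡m a b)

tripleEnumeration : ∀ m → Enumeration (ValidTriple m) (tripleCount m)
tripleEnumeration zero = record
  { enum = λ _ → 0 , 0 , 0
  ; injective = λ { {zero} {zero} _ → refl }
  ; sound = λ _ → refl , z≤n
  ; complete = λ { {zero , zero , zero} _ → zero , refl
                 ; {suc _ , _ , _} (() , _) ; {zero , suc _ , _} (() , _) ; {zero , zero , suc _} (() , _) }
  }
tripleEnumeration (suc m) =
  enumeration-resp (ValidTriple-suc m)
    (enumeration-∪ (λ { ((_ , _ , refl) , (_ , _ , ())) })
      (enumeration-image incrementLast (λ { refl → refl }) (tripleEnumeration m))
      (enumeration-image (twoParts (suc m)) (λ eq → toℕ-injective (cong (proj₁ ∘ proj₂) eq))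
        (enumeration-Fin _)))

Code : ℕ → Set
Code n = Subset n × Triple

-- The offset j lets the recursion on the first entry of S go through; the theorem needs j = 0.
ValidCode : ∀ {n} → ℕ → Pred (Code n) 0ℓ
ValidCode j (S , t) = ValidTriple (∣ S ∣ + j) t

codeCount : ℕ → ℕ → ℕ
codeCount zero    j = tripleCount j
codeCount (suc n) j = codeCount n j + codeCount n (suc j)

prepend : ∀ {n} → Bool → Code n → Code (suc n)
prepend x (S , t) = x ∷ S , t

ValidCode-zero : ∀ j → Image ([] ,_) (ValidTriple j) ≐ ValidCode j
ValidCode-zero j = (λ { (_ , valid , refl) → valid }) , λ { {[] , t} valid → t , valid , refl }

ValidCode-suc : ∀ {n} j →
  Image (prepend false) (ValidCode {n} j) ∪ Image (prepend true) (ValidCode (suc j)) ≐ ValidCode j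
ValidCode-suc j = merge , split
  where
  merge : Image (prepend false) (ValidCode j) ∪ Image (prepend true) (ValidCode (suc j)) ⊆ ValidCode j
  merge (inj₁ (_ , valid , refl))       = valid
  merge (inj₂ ((S , t) , valid , refl)) = subst (λ k → ValidTriple k t) (+-suc ∣ S ∣ j) valid
  split : ValidCode j ⊆ Image (prepend false) (ValidCode j) ∪ Image (prepend true) (ValidCode (suc j))
  split {false ∷ S , t} valid = inj₁ ((S , t) , valid , refl)
  split {true ∷ S , t}  valid =
    inj₂ ((S , t) , subst (λ k → ValidTriple k t) (sym (+-suc ∣ S ∣ j)) valid , refl)

codeEnumeration : ∀ n j → Enumeration (ValidCode {n} j) (codeCount n j)
codeEnumeration zero j =
  enumeration-resp (ValidCode-zero j) (enumeration-image ([] ,_) (λ { refl → refl }) (tripleEnumeration j))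
codeEnumeration (suc n) j =
  enumeration-resp (ValidCode-suc j)
    (enumeration-∪ (λ { ((_ , _ , refl) , (_ , _ , ())) })
      (enumeration-image (prepend false) (λ { {_ , _} {_ , _} refl → refl }) (codeEnumeration n j))
      (enumeration-image (prepend true) (λ { {_ , _} {_ , _} refl → refl }) (codeEnumeration n (suc j))))

-- The floors cancel in the sum of two consecutive values.
tripleCount-consecutive : ∀ j → 2 * (tripleCount j + tripleCount (suc j)) ≡ (j + 2) * (j + 3)
tripleCount-consecutive zero    = refl
tripleCount-consecutive (suc j) = begin
  2 * (tripleCount (suc j) + tripleCount (suc (suc j)))
    ≡⟨ unfold (tripleCount j) ⌊ suc j /2⌋ ⌈ suc j /2⌉ ⟩
  2 * (tripleCount j + tripleCount (suc j)) + 2 * (2 + (⌊ suc j /2⌋ + ⌈ suc j /2⌉))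
    ≡⟨ cong₂ (λ u v → u + 2 * (2 + v)) (tripleCount-consecutive j) (⌊n/2⌋+⌈n/2⌉≡n (suc j)) ⟩
  (j + 2) * (j + 3) + 2 * (2 + suc j)
    ≡⟨ close j ⟩
  (suc j + 2) * (suc j + 3) ∎
  where
  open ≡-Reasoning
  unfold : ∀ t x y → 2 * ((t + suc x) + (t + suc x + suc y)) ≡ 2 * (t + (t + suc x)) + 2 * (2 + (x + y))
  unfold = solve-∀
  close : ∀ j → (j + 2) * (j + 3) + 2 * (2 + suc j) ≡ (suc j + 2) * (suc j + 3)
  close = solve-∀

codeCount-closedForm : ∀ n j →
  16 * codeCount (suc n) j + 2 * 2 ^ suc n ≡ 2 ^ suc n * ((suc n + 2 * j + 4) * (suc n + 2 * j + 4) + suc n)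
codeCount-closedForm zero j = begin
  16 * (tripleCount j + tripleCount (suc j)) + 4 ≡⟨ regroup (tripleCount j + tripleCount (suc j)) ⟩
  8 * (2 * (tripleCount j + tripleCount (suc j))) + 4 ≡⟨ cong (λ u → 8 * u + 4) (tripleCount-consecutive j) ⟩
  8 * ((j + 2) * (j + 3)) + 4                       ≡⟨ expand j ⟩
  2 * ((1 + 2 * j + 4) * (1 + 2 * j + 4) + 1) ∎
  where
  open ≡-Reasoning
  regroup : ∀ x → 16 * x + 4 ≡ 8 * (2 * x) + 4
  regroup = solve-∀
  expand : ∀ j → 8 * ((j + 2) * (j + 3)) + 4 ≡ 2 * ((1 + 2 * j + 4) * (1 + 2 * j + 4) + 1)
  expand = solve-∀
codeCount-closedForm (suc n) j = begin
  16 * (codeCount (suc n) j + codeCount (suc n) (suc j)) + 2 * 2 ^ suc (suc n)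
    ≡⟨ regroup (codeCount (suc n) j) (codeCount (suc n) (suc j)) (2 ^ suc n) ⟩
  (16 * codeCount (suc n) j + 2 * 2 ^ suc n) + (16 * codeCount (suc n) (suc j) + 2 * 2 ^ suc n)
    ≡⟨ cong₂ _+_ (codeCount-closedForm n j) (codeCount-closedForm n (suc j)) ⟩
  2 ^ suc n * ((suc n + 2 * j + 4) * (suc n + 2 * j + 4) + suc n)
    + 2 ^ suc n * ((suc n + 2 * suc j + 4) * (suc n + 2 * suc j + 4) + suc n)
    ≡⟨ merge (2 ^ suc n) n j ⟩
  2 ^ suc (suc n) * ((suc (suc n) + 2 * j + 4) * (suc (suc n) + 2 * j + 4) + suc (suc n)) ∎
  where
  open ≡-Reasoning
  regroup : ∀ a b p → 16 * (a + b) + 2 * (2 * p) ≡ (16 * a + 2 * p) + (16 * b + 2 * p)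
  regroup = solve-∀
  -- (u - 1)² + (u + 1)² = 2u² + 2 with u = m + 2j + 5
  merge : ∀ p n j → p * ((suc n + 2 * j + 4) * (suc n + 2 * j + 4) + suc n)
                      + p * ((suc n + 2 * suc j + 4) * (suc n + 2 * suc j + 4) + suc n)
                  ≡ 2 * p * ((suc (suc n) + 2 * j + 4) * (suc (suc n) + 2 * j + 4) + suc (suc n))
  merge = solve-∀

codeCount-formula : ∀ n → 1 ≤ n →
  16 * codeCount n 0 ≡ n * (n + 1) * 2 ^ n + 8 * n * 2 ^ n + 14 * 2 ^ n
codeCount-formula (suc n) _ =
  +-cancelʳ-≡ (2 * 2 ^ suc n) _ _ (trans (codeCount-closedForm n 0) (expand (2 ^ suc n) (suc n)))
  where
  expand : ∀ p m → p * ((m + 2 * 0 + 4) * (m + 2 * 0 + 4) + m) ≡ m * (m + 1) * p + 8 * m * p + 14 * p + 2 * p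
  expand = solve-∀

-- The invariant of an (n,2)-graph

Row : Set
Row = Bool × Bool

pattern none   = false , false
pattern first  = true  , false
pattern second = false , true
pattern both   = true  , true

_≟ᵣ_ : DecidableEquality Row
_≟ᵣ_ = ≡-dec _≟ᵇ_ _≟ᵇ_

open Counting _≟ᵣ_

count-swap : ∀ {n} (f : Fin n → Row) t → count (swap ∘ f) t ≡ count f (swap t)
count-swap f t = count-cong {f = swap ∘ f} {h = f} (λ _ → cong swap) (λ _ → cong swap)

occupied : Row → Bool
occupied (u , v) = u ∨ v

row : ∀ {n} → BipGraph n 2 → Fin n → Row
row G x = G x 0F , G x 1F

fromRows : ∀ {n} → (Fin n → Row) → BipGraph n 2
fromRows r x 0F = proj₁ (r x)
fromRows r x 1F = proj₂ (r x)

swapColumns : ∀ {n} → BipGraph n 2 → BipGraph n 2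
swapColumns G x y = G x (transpose 0F 1F ⟨$⟩ʳ y)

domain : ∀ {n} → BipGraph n 2 → Subset n
domain G = tabulate (occupied ∘ row G)

InConnDomain⇒occupied : ∀ {n} (G : BipGraph n 2) x → InConnDomain G x → occupied (row G x) ≡ true
InConnDomain⇒occupied G x (0F , G0≡true) = cong (_∨ G x 1F) G0≡true
InConnDomain⇒occupied G x (1F , G1≡true) = trans (cong (G x 0F ∨_) G1≡true) (∨-zeroʳ (G x 0F))

occupied⇒InConnDomain : ∀ {n} (G : BipGraph n 2) x → occupied (row G x) ≡ true → InConnDomain G x
occupied⇒InConnDomain G x occ with G x 0F in G0≡
... | true  = 0F , G0≡
... | false = 1F , occ

SameConnDomain⇒domain≡ : ∀ {n} {G H : BipGraph n 2} → SameConnDomain G H → domain G ≡ domain H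
SameConnDomain⇒domain≡ {G = G} {H} same = tabulate-cong λ x → ⇔→≡ {z = true} (mk⇔
  (InConnDomain⇒occupied H x ∘ proj₁ (same x) ∘ occupied⇒InConnDomain G x)
  (InConnDomain⇒occupied G x ∘ proj₂ (same x) ∘ occupied⇒InConnDomain H x))

domain≡⇒occupied≡ : ∀ {n} {G H : BipGraph n 2} → domain G ≡ domain H →
                    ∀ x → occupied (row G x) ≡ occupied (row H x)
domain≡⇒occupied≡ {G = G} {H} dom≡ x = begin
  occupied (row G x)       ≡⟨ lookup∘tabulate (occupied ∘ row G) x ⟨
  lookup (domain G) x      ≡⟨ cong (λ S → lookup S x) dom≡ ⟩
  lookup (domain H) x      ≡⟨ lookup∘tabulate (occupied ∘ row H) x ⟩
  occupied (row H x)       ∎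
  where open ≡-Reasoning

domain≡⇒SameConnDomain : ∀ {n} {G H : BipGraph n 2} → domain G ≡ domain H → SameConnDomain G H
domain≡⇒SameConnDomain {G = G} {H} dom≡ x =
    (λ inG → occupied⇒InConnDomain H x (trans (sym occ≡) (InConnDomain⇒occupied G x inG)))
  , (λ inH → occupied⇒InConnDomain G x (trans occ≡ (InConnDomain⇒occupied H x inH)))
  where
  occ≡ : occupied (row G x) ≡ occupied (row H x)
  occ≡ = domain≡⇒occupied≡ {G = G} {H} dom≡ x

domain-swapColumns : ∀ {n} (G : BipGraph n 2) → domain (swapColumns G) ≡ domain G
domain-swapColumns G = tabulate-cong λ x → ∨-comm (G x 1F) (G x 0F)

profile : ∀ {n} → Subset n → ℕ → ℕ → ℕ → Code n
profile S a b c = S , a ⊔ b , a ⊓ b , c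

invariant : ∀ {n} → BipGraph n 2 → Code n
invariant G = profile (domain G) (count (row G) first) (count (row G) second) (count (row G) both)

profile-sorted : ∀ {n} (S : Subset n) {a b} c → b ≤ a → profile S a b c ≡ (S , a , b , c)
profile-sorted S c b≤a = cong₂ (λ a b → S , a , b , c) (m≥n⇒m⊔n≡m b≤a) (m≥n⇒m⊓n≡n b≤a)

profile-swap : ∀ {n} (S : Subset n) a b c → profile S a b c ≡ profile S b a c
profile-swap S a b c = cong₂ (λ x y → S , x , y , c) (⊔-comm a b) (⊓-comm a b)

profile-injective : ∀ {n} {S S′ : Subset n} {a b c a′ b′ c′} → profile S a b c ≡ profile S′ a′ b′ c′ →
  S ≡ S′ × c ≡ c′ × ((a ≡ a′ × b ≡ b′) ⊎ (a ≡ b′ × b ≡ a′))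
profile-injective eq =
  let S≡ , eq₁ = ,-injective eq ; max≡ , eq₂ = ,-injective eq₁ ; min≡ , c≡ = ,-injective eq₂
  in S≡ , c≡ , ⊔⊓-injective (cong₂ _,_ max≡ min≡)

profile-cong : ∀ {n} {S S′ : Subset n} {a b c a′ b′ c′} →
  S ≡ S′ → a ≡ a′ → b ≡ b′ → c ≡ c′ → profile S a b c ≡ profile S′ a′ b′ c′
profile-cong refl refl refl refl = refl

⟨$⟩ʳ-injective : ∀ {n} (π : Permutation′ n) → Injective _≡_ _≡_ (π ⟨$⟩ʳ_)
⟨$⟩ʳ-injective π eq = trans (sym (inverseˡ π)) (trans (cong (π ⟨$⟩ˡ_) eq) (inverseˡ π))

permutation₂-cases : (β : Permutation′ 2) →
  (β ⟨$⟩ʳ 0F ≡ 0F × β ⟨$⟩ʳ 1F ≡ 1F) ⊎ (β ⟨$⟩ʳ 0F ≡ 1F × β ⟨$⟩ʳ 1F ≡ 0F)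
permutation₂-cases β with β ⟨$⟩ʳ 0F in β0 | β ⟨$⟩ʳ 1F in β1
... | 0F | 1F = inj₁ (refl , refl)
... | 1F | 0F = inj₂ (refl , refl)
... | 0F | 0F = contradiction (⟨$⟩ʳ-injective β (trans β0 (sym β1))) λ ()
... | 1F | 1F = contradiction (⟨$⟩ʳ-injective β (trans β0 (sym β1))) λ ()

rows-related : ∀ {n} {G H : BipGraph n 2} (α : Permutation′ n) (β : Permutation′ 2) →
  (∀ x y → G x y ≡ H (α ⟨$⟩ʳ x) (β ⟨$⟩ʳ y)) →
  (∀ x → row G x ≡ row H (α ⟨$⟩ʳ x)) ⊎ (∀ x → row G x ≡ swap (row H (α ⟨$⟩ʳ x)))
rows-related {H = H} α β G≡H with permutation₂-cases β
... | inj₁ (β0 , β1) = inj₁ λ x →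
  cong₂ _,_ (trans (G≡H x 0F) (cong (H (α ⟨$⟩ʳ x)) β0)) (trans (G≡H x 1F) (cong (H (α ⟨$⟩ʳ x)) β1))
... | inj₂ (β0 , β1) = inj₂ λ x →
  cong₂ _,_ (trans (G≡H x 0F) (cong (H (α ⟨$⟩ʳ x)) β0)) (trans (G≡H x 1F) (cong (H (α ⟨$⟩ʳ x)) β1))

invariant-resp : ∀ {n} {G H : BipGraph n 2} → LSLEquiv G H → invariant G ≡ invariant H
invariant-resp {G = G} {H} ((α , β , G≡H) , same) with rows-related {G = G} {H} α β G≡H
... | inj₁ rows≡ = profile-cong dom≡ (counts≡ first) (counts≡ second) (counts≡ both)
  where
  dom≡ : domain G ≡ domain H
  dom≡ = SameConnDomain⇒domain≡ same
  counts≡ : ∀ t → count (row G) t ≡ count (row H) t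
  counts≡ = count-reindex {h = row H} α rows≡
... | inj₂ rows≡ = begin
  invariant G
    ≡⟨ profile-cong dom≡ (counts≡ first) (counts≡ second) (counts≡ both) ⟩
  profile (domain H) (count (row H) second) (count (row H) first) (count (row H) both)
    ≡⟨ profile-swap (domain H) _ _ _ ⟩
  invariant H ∎
  where
  open ≡-Reasoning
  dom≡ : domain G ≡ domain H
  dom≡ = SameConnDomain⇒domain≡ same
  counts≡ : ∀ t → count (row G) t ≡ count (row H) (swap t)
  counts≡ t = trans (count-reindex {h = swap ∘ row H} α rows≡ t) (count-swap (row H) t)

LSLEquiv-trans : ∀ {n r} {G H K : BipGraph n r} → LSLEquiv G H → LSLEquiv H K → LSLEquiv G K
LSLEquiv-trans ((α , β , G≡H) , G~H) ((α′ , β′ , H≡K) , H~K) =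
    (α ∘ₚ α′ , β ∘ₚ β′ , λ x y → trans (G≡H x y) (H≡K _ _))
  , λ x → proj₁ (H~K x) ∘ proj₁ (G~H x) , proj₂ (G~H x) ∘ proj₂ (H~K x)

swapColumns-LSLEquiv : ∀ {n} (G : BipGraph n 2) → LSLEquiv (swapColumns G) G
swapColumns-LSLEquiv G =
  (Perm.id , transpose 0F 1F , λ _ _ → refl) , domain≡⇒SameConnDomain (domain-swapColumns G)

occupied≡false⇒none : ∀ u → occupied u ≡ false → u ≡ none
occupied≡false⇒none none _ = refl

sameCounts⇒LSLEquiv : ∀ {n} {G H : BipGraph n 2} → domain G ≡ domain H →
  count (row G) first ≡ count (row H) first → count (row G) second ≡ count (row H) second →
  count (row G) both ≡ count (row H) both → LSLEquiv G H
sameCounts⇒LSLEquiv {n} {G} {H} dom≡ first≡ second≡ both≡ =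
  (π , Perm.id , related) , domain≡⇒SameConnDomain dom≡
  where
  occ≡ : ∀ x → occupied (row G x) ≡ occupied (row H x)
  occ≡ = domain≡⇒occupied≡ {G = G} {H} dom≡
  counts≡ : ∀ t → count (row G) t ≡ count (row H) t
  counts≡ none   = count-cong {f = row G} {h = row H}
    (λ x G≡none → occupied≡false⇒none _ (trans (sym (occ≡ x)) (cong occupied G≡none)))
    (λ x H≡none → occupied≡false⇒none _ (trans (occ≡ x) (cong occupied H≡none)))
  counts≡ first  = first≡
  counts≡ second = second≡
  counts≡ both   = both≡
  π,π-spec : Σ (Permutation′ n) λ π → ∀ x → row G x ≡ row H (π ⟨$⟩ʳ x)
  π,π-spec = sameCounts⇒permutation (row G) (row H) counts≡
  π : Permutation′ n
  π = proj₁ π,π-spec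
  related : ∀ x y → G x y ≡ H (π ⟨$⟩ʳ x) y
  related x 0F = cong proj₁ (proj₂ π,π-spec x)
  related x 1F = cong proj₂ (proj₂ π,π-spec x)

invariant-reflects : ∀ {n} {G H : BipGraph n 2} → invariant G ≡ invariant H → LSLEquiv G H
invariant-reflects {G = G} {H} eq with profile-injective eq
... | dom≡ , both≡ , inj₁ (first≡ , second≡) = sameCounts⇒LSLEquiv dom≡ first≡ second≡ both≡
... | dom≡ , both≡ , inj₂ (first≡ , second≡) = LSLEquiv-trans
  (sameCounts⇒LSLEquiv {H = swapColumns H} (trans dom≡ (sym (domain-swapColumns H)))
    (trans first≡ (sym (count-swap (row H) first)))
    (trans second≡ (sym (count-swap (row H) second)))
    (trans both≡ (sym (count-swap (row H) both))))
  (swapColumns-LSLEquiv H)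

∣tabulate-occupied∣ : ∀ {n} (r : Fin n → Row) →
  ∣ tabulate (occupied ∘ r) ∣ ≡ count r first + count r second + count r both
∣tabulate-occupied∣ {zero}  r = refl
∣tabulate-occupied∣ {suc n} r with r zero | ∣tabulate-occupied∣ (r ∘ suc)
... | none   | ih = ih
... | first  | ih = cong suc ih
... | second | ih = trans (cong suc ih) (cong (_+ count (r ∘ suc) both) (sym (+-suc _ _)))
... | both   | ih = trans (cong suc ih) (sym (+-suc _ _))

invariant-valid : ∀ {n} (G : BipGraph n 2) → ValidCode 0 (invariant G)
invariant-valid G = sum≡ , m⊓n≤m⊔n a b
  where
  a b c : ℕ
  a = count (row G) first
  b = count (row G) second
  c = count (row G) both
  sum≡ : a ⊔ b + a ⊓ b + c ≡ ∣ domain G ∣ + 0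
  sum≡ = begin
    a ⊔ b + a ⊓ b + c        ≡⟨ cong (_+ c) (m⊔n+m⊓n≡m+n a b) ⟩
    a + b + c                ≡⟨ ∣tabulate-occupied∣ (row G) ⟨
    ∣ domain G ∣             ≡⟨ +-identityʳ _ ⟨
    ∣ domain G ∣ + 0         ∎
    where open ≡-Reasoning

fill : ∀ {n} → Subset n → ℕ → ℕ → ℕ → Vec Row n
fill []          _       _       _ = []
fill (false ∷ S) a       b       c = none   ∷ fill S a b c
fill (true ∷ S)  (suc a) b       c = first  ∷ fill S a b c
fill (true ∷ S)  zero    (suc b) c = second ∷ fill S zero b c
fill (true ∷ S)  zero    zero    c = both   ∷ fill S zero zero (pred c)

fill-correct : ∀ {n} (S : Subset n) a b c → a + b + c ≡ ∣ S ∣ →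
  let r = lookup (fill S a b c) in
  tabulate (occupied ∘ r) ≡ S × count r first ≡ a × count r second ≡ b × count r both ≡ c
fill-correct []          zero    zero    zero    _   = refl , refl , refl , refl
fill-correct (false ∷ S) a       b       c       eq  =
  let S≡ , a≡ , b≡ , c≡ = fill-correct S a b c eq
  in cong (false ∷_) S≡ , a≡ , b≡ , c≡
fill-correct (true ∷ S)  (suc a) b       c       eq  =
  let S≡ , a≡ , b≡ , c≡ = fill-correct S a b c (suc-injective eq)
  in cong (true ∷_) S≡ , cong suc a≡ , b≡ , c≡
fill-correct (true ∷ S)  zero    (suc b) c       eq  =
  let S≡ , a≡ , b≡ , c≡ = fill-correct S zero b c (suc-injective eq)
  in cong (true ∷_) S≡ , a≡ , cong suc b≡ , c≡
fill-correct (true ∷ S)  zero    zero    (suc c) eq  =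
  let S≡ , a≡ , b≡ , c≡ = fill-correct S zero zero c (suc-injective eq)
  in cong (true ∷_) S≡ , a≡ , b≡ , cong suc c≡

invariant-realize : ∀ {n} {code : Code n} → ValidCode 0 code → ∃[ G ] invariant G ≡ code
invariant-realize {code = S , a , b , c} (sum≡ , b≤a)
  with fill-correct S a b c (trans sum≡ (+-identityʳ _))
... | S≡ , a≡ , b≡ , c≡ =
  fromRows (lookup (fill S a b c)) , trans (profile-cong S≡ a≡ b≡ c≡) (profile-sorted S c b≤a)

invariant-complete : ∀ n → CompleteInvariant (LSLEquiv {n} {2}) (ValidCode 0)
invariant-complete n = record
  { inv = invariant ; respects = invariant-resp ; reflects = invariant-reflects
  ; valid = invariant-valid ; onto = invariant-realize }

cardBx₂ : ∀ n → CardBx n 2 (codeCount n 0)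
cardBx₂ n = completeInvariant⇒HasClassCount (invariant-complete n) (codeEnumeration n 0)

mainTheorem3 : (n : ℕ) → 1 ≤ n →
    ∃[ k ] CardBx n 2 k
      × 16 * k ≡ n * (n + 1) * 2 ^ n + 8 * n * 2 ^ n + 14 * 2 ^ n
mainTheorem3 n 1≤n = codeCount n 0 , cardBx₂ n , codeCount-formula n 1≤n
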